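{- Let $D$ be a strict and asymmetric digraph of order $n$. Then the number of components $c(L(D))$ of the line graph $L(D)$ satisfies $c(L(D))\leq f(n)$, where $f(n)=\frac{n^{2}-1}{4}$ if $n$ is odd and $f(n)=\frac{n^{2}}{4}$ if $n$ is even. Moreover, equality holds if and only if either $D$ is the transitive tournament of order $3$, or $V(D)$ can be partitioned into sets $X, Y$ with $||X|-|Y||\leq 1$ such that the arc set of $D$ is exactly $\{(x,y): x\in X,\ y\in Y\}$.
   Context: A digraph is strict if it has no loops and no parallel arcs; it is asymmetric if whenever $(u,v)$ is an arc, $(v,u)$ is not an arc. The line graph $L(D)$ of a digraph $D$ is the graph whose vertex set is the arc set of $D$, in which two arcs are adjacent if and only if they form a directed path of length $2$ (arcs $(u,v),(v,w)$ with $u,v,w$ distinct). The transitive tournament of order $3$ is the digraph with vertices $a,b,c$ and arcs $(a,b),(a,c),(b,c)$. -}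

module Defs where

open import Data.Bool using (Bool; true; false)
open import Data.Nat using (ℕ; _*_; _∸_; _%_; _/_; _≤_; ∣_-_∣)
open import Data.Fin using (Fin; zero; suc)
open import Data.Fin.Subset using (Subset; _∈_; _∉_; ∁; ∣_∣)
open import Data.Product using (Σ; _×_; _,_; ∃)
open import Relation.Binary.PropositionalEquality using (_≡_; _≢_)
open import Relation.Binary.Construct.Closure.Symmetric using (SymClosure)
open import Relation.Binary.Construct.Closure.ReflexiveTransitive using (Star)
open import Function.Definitions using (Surjective; Bijective)
open import Function.Bundles using (_⇔_)

Digraph : ℕ → Set
Digraph n = Fin n → Fin n → Bool

Arc : ∀ {n} → Digraph n → Fin n → Fin n → Set
Arc D u v = D u v ≡ true

-- strict: no loops (and no parallel arcs, automatic in this representation)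
Strict : ∀ {n} → Digraph n → Set
Strict {n} D = ∀ (u : Fin n) → D u u ≡ false

Asymmetric : ∀ {n} → Digraph n → Set
Asymmetric {n} D = ∀ (u v : Fin n) → Arc D u v → D v u ≡ false

record ArcOf {n : ℕ} (D : Digraph n) : Set where
  constructor arc
  field
    tail : Fin n
    head : Fin n
    isArc : Arc D tail head

open ArcOf public

Path2 : ∀ {n} {D : Digraph n} → ArcOf D → ArcOf D → Set
Path2 a b = head a ≡ tail b × tail a ≢ head a × head a ≢ head b × tail a ≢ head b

LAdj : ∀ {n} {D : Digraph n} → ArcOf D → ArcOf D → Set
LAdj a b = SymClosure Path2 a b

Connected : ∀ {n} {D : Digraph n} → ArcOf D → ArcOf D → Set
Connected = Star LAdj

-- "L(D) has exactly k components": there is a surjective labelling of the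
-- vertices of L(D) by Fin k whose fibres are exactly the components.
NumComponents : ∀ {n} (D : Digraph n) → ℕ → Set
NumComponents D k =
  Σ (ArcOf D → Fin k) λ comp →
    Surjective _≡_ _≡_ comp × (∀ a b → (comp a ≡ comp b) ⇔ Connected a b)

-- f(n) = (n²-1)/4 for n odd, n²/4 for n even
f : ℕ → ℕ
f n = (n * n ∸ n % 2) / 4

TT3 : Digraph 3
TT3 zero (suc zero) = true
TT3 zero (suc (suc zero)) = true
TT3 (suc zero) (suc (suc zero)) = true
TT3 _ _ = false

IsTT3 : ∀ {n} → Digraph n → Set
IsTT3 {n} D = Σ (Fin 3 → Fin n) λ σ →
  Bijective _≡_ _≡_ σ × (∀ i j → D (σ i) (σ j) ≡ TT3 i j)

IsBalancedBipartiteOrientation : ∀ {n} → Digraph n → Set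
IsBalancedBipartiteOrientation {n} D = Σ (Subset n) λ X →
  ∣ ∣ X ∣ - ∣ ∁ X ∣ ∣ ≤ 1 ×
  (∀ u v → Arc D u v ⇔ (u ∈ X × v ∈ ∁ X))

module Submission where

-- Call a vertex mixed if it has both an in-arc and an out-arc; all arcs at a mixed vertex lie in one
-- component of L(D). Let X consist of the sources together with, for every component containing
-- mixed vertices, the least of them. Every component then contains an arc from X to V ∖ X: an arc
-- between unmixed vertices runs from a source to a vertex outside X, and otherwise the out-arcs of
-- the chosen mixed vertex do, since no successor of a chosen vertex is chosen. Hence
-- c(L(D)) ≤ |X| |V ∖ X| ≤ f(n), as f(p + q) = pq + f(|p − q|).
-- At equality each pair in X × (V ∖ X) is an arc and distinct such arcs lie in distinct components.
-- A chosen vertex then has a single successor, so |V ∖ X| = 1, n = 3 and D is the transitive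
-- tournament; without mixed vertices D is the complete orientation from X to V ∖ X. Conversely, in
-- a complete orientation from X to Y every arc is alone in its component, giving |X| |Y| components,
-- and in the transitive tournament the arc from source to sink is isolated, giving two.

open import Defs
open import Data.Bool using (true; false)
import Data.Bool.Properties as Bool
open import Data.Empty using (⊥)
open import Data.Fin using (Fin; zero; suc; combine; remQuot; punchOut) renaming (_<_ to _<ᶠ_)
open import Data.Fin.Properties
  using (any?; all?; _<?_; <-cmp; combine-injective; combine-remQuot; injective⇒≤;
         punchOut-injective; cantor-schröder-bernstein; suc-injective)
  renaming (_≟_ to _≟ᶠ_)
open import Data.Fin.Subset using (Subset; inside; outside; _∈_; ∁; ∣_∣; ⁅_⁆)
open import Data.Fin.Subset.Properties
  using (_∈?_; x∉p⇒x∈∁p; x∈∁p⇒x∉p; ∣∁p∣≡n∸∣p∣; ∣p∣≤n; p⊆q⇒∣p∣≤∣q∣; ∣⁅x⁆∣≡1; x∈⁅x⁆)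
open import Data.Maybe using (Maybe; just; nothing)
open import Data.Maybe.Properties using (just-injective) renaming (≡-dec to ≡-decᴹ)
open import Data.Nat using (ℕ; zero; suc; _+_; _*_; _∸_; _%_; _/_; _≤_; _<_; z≤n; s≤s; ∣_-_∣)
open import Data.Nat.Properties
  using (≤-trans; ≤-antisym; ≤-reflexive; ≤-total; +-comm; *-comm; +-identityʳ; +-cancelˡ-≡;
         +-∸-assoc; m+[n∸m]≡n; m≤m+n; m≤m*n; +-mono-≤; ∸-mono; *-mono-≤; 1+n≰n; m≤∣m-n∣+n;
         m≤n⇒∃[o]m+o≡n; ∣m-m+n∣≡n; ∣-∣-comm; ≤-pred)
open import Data.Nat.DivMod using ([m+kn]%n≡m%n; m%n≤m; m%n<n; +-distrib-/-∣ˡ; m*n/n≡m; m≥n⇒m/n>0)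
open import Data.Nat.Divisibility using (divides-refl)
open import Data.Nat.Tactic.RingSolver using (solve-∀)
open import Data.Product using (∃; _×_; _,_; proj₁; proj₂; uncurry)
open import Data.Sum using (_⊎_; inj₁; inj₂; [_,_])
open import Data.Vec using (_∷_; tabulate; here; there)
open import Data.Vec.Properties using (lookup∘tabulate; []=⇒lookup; lookup⇒[]=)
open import Function using (_∘_)
open import Function.Bundles using (_⇔_; mk⇔; Equivalence)
open import Function.Definitions using (Injective; Surjective; Bijective)
open import Relation.Binary.PropositionalEquality
  using (_≡_; _≢_; refl; sym; trans; cong; cong₂; subst; subst₂; module ≡-Reasoning)
open import Relation.Binary.Construct.Closure.Symmetric using (fwd; bwd)
open import Relation.Binary.Construct.Closure.ReflexiveTransitive using (ε; _◅_)
open import Relation.Binary.Definitions using (Tri; tri<; tri≈; tri>)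
open import Relation.Nullary using (¬_; Dec; yes; no; does; contradiction)
open import Relation.Nullary.Decidable using (_×-dec_; _⊎-dec_; _→-dec_; ¬?; dec-true; dec-false)
open import Relation.Unary using (Pred; Decidable)
open import Axiom.UniquenessOfIdentityProofs using (module Decidable⇒UIP)

least : ∀ {m ℓ} {Q : Pred (Fin m) ℓ} → Decidable Q → ∃ Q →
        ∃ λ v → Q v × (∀ u → u <ᶠ v → ¬ Q u)
least {suc m} {Q = Q} Q? ∃Q with Q? zero
... | yes q₀ = zero , q₀ , λ u ()
... | no ¬q₀ =
  let v , qv , minimal = least (Q? ∘ suc) (above-zero ∃Q) in
  suc v , qv , λ { zero _ → ¬q₀ ; (suc u) (s≤s u<v) → minimal u u<v }
  where
  above-zero : ∃ Q → ∃ (Q ∘ suc)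
  above-zero (zero , q) = contradiction q ¬q₀
  above-zero (suc x , q) = x , q

injective⇒surjective : ∀ {m m′} → m ≡ m′ → {h : Fin m → Fin m′} →
                       Injective _≡_ _≡_ h → Surjective _≡_ _≡_ h
injective⇒surjective {suc m} refl {h} h-injective y with any? (λ x → h x ≟ᶠ y)
... | yes (x , hx≡y) = x , λ { refl → hx≡y }
... | no ∄x = contradiction (injective⇒≤ punched-injective) 1+n≰n
  where
  y≢h : ∀ x → y ≢ h x
  y≢h x y≡hx = ∄x (x , sym y≡hx)
  punched : Fin (suc m) → Fin m
  punched x = punchOut (y≢h x)
  punched-injective : Injective _≡_ _≡_ punched
  punched-injective {a} {b} = h-injective ∘ punchOut-injective (y≢h a) (y≢h b)

bijective⇒≡ : ∀ {m m′} {h : Fin m → Fin m′} → Bijective _≡_ _≡_ h → m ≡ m′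
bijective⇒≡ {h = h} (h-injective , h-surjective) =
  cantor-schröder-bernstein h-injective section-injective
  where
  section-injective : Injective _≡_ _≡_ (proj₁ ∘ h-surjective)
  section-injective {a} {b} e =
    trans (sym (proj₂ (h-surjective a) refl)) (trans (cong h e) (proj₂ (h-surjective b) refl))

remQuot-injective : ∀ {m} k {s t : Fin (m * k)} → remQuot {m} k s ≡ remQuot k t → s ≡ t
remQuot-injective {m} k {s} {t} e =
  trans (sym (combine-remQuot {m} k s)) (trans (cong (uncurry combine) e) (combine-remQuot {m} k t))

select : ∀ {n ℓ} {Q : Pred (Fin n) ℓ} → Decidable Q → Subset n
select Q? = tabulate (does ∘ Q?)

module _ {n ℓ} {Q : Pred (Fin n) ℓ} (Q? : Decidable Q) where

  select-∈ : ∀ {x} → Q x → x ∈ select Q?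
  select-∈ {x} qx = lookup⇒[]= x _ (trans (lookup∘tabulate _ x) (dec-true (Q? x) qx))

  select-∁ : ∀ {x} → ¬ Q x → x ∈ ∁ (select Q?)
  select-∁ {x} ¬qx = x∉p⇒x∈∁p λ x∈ →
    contradiction (trans (sym ([]=⇒lookup x∈)) (trans (lookup∘tabulate _ x) (dec-false (Q? x) ¬qx))) λ ()

index : ∀ {n} (p : Subset n) {x} → x ∈ p → Fin ∣ p ∣
index (inside ∷ p) here = zero
index (inside ∷ p) (there x∈p) = suc (index p x∈p)
index (outside ∷ p) (there x∈p) = index p x∈p

index-injective : ∀ {n} (p : Subset n) {x y} (x∈p : x ∈ p) (y∈p : y ∈ p) →
                  index p x∈p ≡ index p y∈p → x ≡ y
index-injective (inside ∷ p) here here _ = refl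
index-injective (inside ∷ p) (there x∈p) (there y∈p) e =
  cong suc (index-injective p x∈p y∈p (suc-injective e))
index-injective (outside ∷ p) (there x∈p) (there y∈p) e = cong suc (index-injective p x∈p y∈p e)

element : ∀ {n} (p : Subset n) → Fin ∣ p ∣ → Fin n
element (inside ∷ p) zero = zero
element (inside ∷ p) (suc i) = suc (element p i)
element (outside ∷ p) i = suc (element p i)

element-∈ : ∀ {n} (p : Subset n) i → element p i ∈ p
element-∈ (inside ∷ p) zero = here
element-∈ (inside ∷ p) (suc i) = there (element-∈ p i)
element-∈ (outside ∷ p) i = there (element-∈ p i)

element-injective : ∀ {n} (p : Subset n) → Injective _≡_ _≡_ (element p)
element-injective (inside ∷ p) {zero} {zero} _ = refl
element-injective (inside ∷ p) {suc i} {suc j} e = cong suc (element-injective p (suc-injective e))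
element-injective (outside ∷ p) e = element-injective p (suc-injective e)

∣p∣+∣∁p∣≡n : ∀ {n} (p : Subset n) → ∣ p ∣ + ∣ ∁ p ∣ ≡ n
∣p∣+∣∁p∣≡n p = trans (cong (∣ p ∣ +_) (∣∁p∣≡n∸∣p∣ p)) (m+[n∸m]≡n (∣p∣≤n p))

-- The identity (p + q)² = 4pq + (p − q)², read through the floor in f.
f-+-diagonal : ∀ p d → f (p + (p + d)) ≡ p * (p + d) + f d
f-+-diagonal p d = begin
    (m * m ∸ m % 2) / 4
  ≡⟨ cong₂ (λ a b → (a ∸ b) / 4) (square p d) parity ⟩
    (p * (p + d) * 4 + d * d ∸ d % 2) / 4
  ≡⟨ cong (_/ 4) (+-∸-assoc (p * (p + d) * 4) (parity≤square d)) ⟩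
    (p * (p + d) * 4 + (d * d ∸ d % 2)) / 4
  ≡⟨ +-distrib-/-∣ˡ (d * d ∸ d % 2) (divides-refl (p * (p + d))) ⟩
    p * (p + d) * 4 / 4 + f d
  ≡⟨ cong (_+ f d) (m*n/n≡m (p * (p + d)) 4) ⟩
    p * (p + d) + f d ∎
  where
  open ≡-Reasoning
  m = p + (p + d)
  square : ∀ p d → (p + (p + d)) * (p + (p + d)) ≡ p * (p + d) * 4 + d * d
  square = solve-∀
  linear : ∀ p d → p + (p + d) ≡ d + p * 2
  linear = solve-∀
  parity : m % 2 ≡ d % 2
  parity = trans (cong (_% 2) (linear p d)) ([m+kn]%n≡m%n d p 2)
  parity≤square : ∀ d → d % 2 ≤ d * d
  parity≤square zero = z≤n
  parity≤square d@(suc _) = ≤-trans (m%n≤m d 2) (m≤m*n d d)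

f-+-≤ : ∀ {p q} → p ≤ q → f (p + q) ≡ p * q + f ∣ p - q ∣
f-+-≤ {p} p≤q with d , refl ← m≤n⇒∃[o]m+o≡n p≤q =
  trans (f-+-diagonal p d) (cong (λ e → p * (p + d) + f e) (sym (∣m-m+n∣≡n p d)))

f-+ : ∀ p q → f (p + q) ≡ p * q + f ∣ p - q ∣
f-+ p q with ≤-total p q
... | inj₁ p≤q = f-+-≤ p≤q
... | inj₂ q≤p = begin
    f (p + q)           ≡⟨ cong f (+-comm p q) ⟩
    f (q + p)           ≡⟨ f-+-≤ q≤p ⟩
    q * p + f ∣ q - p ∣ ≡⟨ cong₂ (λ a b → a + f b) (*-comm q p) (∣-∣-comm q p) ⟩
    p * q + f ∣ p - q ∣ ∎
  where open ≡-Reasoning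

f[2+d]>0 : ∀ d → 0 < f (suc (suc d))
f[2+d]>0 zero = s≤s z≤n
f[2+d]>0 (suc e) = m≥n⇒m/n>0 (≤-trans (s≤s (s≤s (s≤s (s≤s z≤n)))) (∸-mono {9} 9≤d*d (≤-pred (m%n<n d 2))))
  where
  d = suc (suc (suc e))
  9≤d*d : 9 ≤ d * d
  9≤d*d = *-mono-≤ {3} {d} {3} {d} (s≤s (s≤s (s≤s z≤n))) (s≤s (s≤s (s≤s z≤n)))

f≡0⇔≤1 : ∀ d → f d ≡ 0 ⇔ d ≤ 1
f≡0⇔≤1 zero = mk⇔ (λ _ → z≤n) (λ _ → refl)
f≡0⇔≤1 (suc zero) = mk⇔ (λ _ → s≤s z≤n) (λ _ → refl)
f≡0⇔≤1 (suc (suc d)) = mk⇔ (λ f≡0 → contradiction (subst (0 <_) f≡0 (f[2+d]>0 d)) λ ()) λ { (s≤s ()) }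

*≤f[+] : ∀ p q → p * q ≤ f (p + q)
*≤f[+] p q = subst (p * q ≤_) (sym (f-+ p q)) (m≤m+n (p * q) _)

*≡f[+]⇔∣-∣≤1 : ∀ p q → p * q ≡ f (p + q) ⇔ ∣ p - q ∣ ≤ 1
*≡f[+]⇔∣-∣≤1 p q = mk⇔
  (λ e → Equivalence.to (f≡0⇔≤1 _)
    (+-cancelˡ-≡ (p * q) _ 0 (trans (sym (trans e (f-+ p q))) (sym (+-identityʳ _)))))
  (λ ≤1 → begin
    p * q               ≡⟨ +-identityʳ (p * q) ⟨
    p * q + 0           ≡⟨ cong (p * q +_) (Equivalence.from (f≡0⇔≤1 _) ≤1) ⟨
    p * q + f ∣ p - q ∣ ≡⟨ f-+ p q ⟨
    f (p + q)           ∎)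
  where open ≡-Reasoning

TT3-complete : ∀ i j → i ≢ j → TT3 i j ≡ true ⊎ TT3 j i ≡ true
TT3-complete zero zero i≢j = contradiction refl i≢j
TT3-complete zero (suc zero) _ = inj₁ refl
TT3-complete zero (suc (suc zero)) _ = inj₁ refl
TT3-complete (suc zero) zero _ = inj₂ refl
TT3-complete (suc zero) (suc zero) i≢j = contradiction refl i≢j
TT3-complete (suc zero) (suc (suc zero)) _ = inj₁ refl
TT3-complete (suc (suc zero)) zero _ = inj₂ refl
TT3-complete (suc (suc zero)) (suc zero) _ = inj₂ refl
TT3-complete (suc (suc zero)) (suc (suc zero)) i≢j = contradiction refl i≢j

TT3-source : ∀ i → TT3 i zero ≡ false
TT3-source zero = refl
TT3-source (suc zero) = refl
TT3-source (suc (suc zero)) = refl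

module LineGraph {n} (D : Digraph n) (strict : Strict D) (asym : Asymmetric D) where

  arc-≡ : ∀ {a b : ArcOf D} → tail a ≡ tail b → head a ≡ head b → a ≡ b
  arc-≡ {arc u v p} {arc .u .v q} refl refl = cong (arc u v) (Decidable⇒UIP.≡-irrelevant Bool._≟_ p q)

  Arc⇒≢ : ∀ {u v} → Arc D u v → u ≢ v
  Arc⇒≢ {u} p refl = contradiction (trans (sym p) (strict u)) λ ()

  Arc⇒¬Arc-reverse : ∀ {u v} → Arc D u v → ¬ Arc D v u
  Arc⇒¬Arc-reverse {u} {v} p q = contradiction (trans (sym q) (asym u v p)) λ ()

  consecutive⇒Path2 : ∀ a b → head a ≡ tail b → Path2 a b
  consecutive⇒Path2 (arc u v p) (arc .v w q) refl =
    refl , Arc⇒≢ p , Arc⇒≢ q , λ u≡w → Arc⇒¬Arc-reverse p (subst (Arc D v) (sym u≡w) q)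

  In Out Mixed Source : Fin n → Set
  In v = ∃ λ u → Arc D u v
  Out v = ∃ λ w → Arc D v w
  Mixed v = In v × Out v
  Source v = Out v × ¬ In v

  In? : Decidable In
  Out? : Decidable Out
  Mixed? : Decidable Mixed
  Source? : Decidable Source
  In? v = any? (λ u → D u v Bool.≟ true)
  Out? v = any? (λ w → D v w Bool.≟ true)
  Mixed? v = In? v ×-dec Out? v
  Source? v = Out? v ×-dec ¬? (In? v)

  inArc : ∀ {v} → In v → ArcOf D
  inArc {v} (u , p) = arc u v p

  outArc : ∀ {v} → Out v → ArcOf D
  outArc {v} (w , p) = arc v w p

  Incident : ArcOf D → Fin n → Set
  Incident a v = tail a ≡ v ⊎ head a ≡ v

  source-sink-isolated : ∀ {a} → ¬ In (tail a) → ¬ Out (head a) → ∀ c → ¬ LAdj a c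
  source-sink-isolated ¬in ¬out c (fwd (head≡tail , _)) =
    ¬out (head c , subst (λ x → Arc D x (head c)) (sym head≡tail) (isArc c))
  source-sink-isolated ¬in ¬out c (bwd (head≡tail , _)) =
    ¬in (tail c , subst (Arc D (tail c)) head≡tail (isArc c))

  isolated : ∀ {a b : ArcOf D} → (∀ c → ¬ LAdj a c) → Connected a b → a ≡ b
  isolated _ ε = refl
  isolated no-neighbour (a~c ◅ _) = contradiction a~c (no-neighbour _)

  TT3-table⇒injective : ∀ {σ : Fin 3 → Fin n} → (∀ i j → D (σ i) (σ j) ≡ TT3 i j) → Injective _≡_ _≡_ σ
  TT3-table⇒injective {σ} table {i} {j} σi≡σj with i ≟ᶠ j
  ... | yes i≡j = i≡j
  ... | no i≢j = contradiction (TT3-complete i j i≢j) [ no-loop i j σi≡σj , no-loop j i (sym σi≡σj) ]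
    where
    no-loop : ∀ a b → σ a ≡ σ b → ¬ TT3 a b ≡ true
    no-loop a b σa≡σb t =
      contradiction (trans (sym (strict (σ a))) (trans (cong (D (σ a)) σa≡σb) (trans (table a b) t))) λ ()

  module Components {k} (comp : ArcOf D → Fin k) (comp-surjective : Surjective _≡_ _≡_ comp)
                    (comp-fibres : ∀ a b → (comp a ≡ comp b) ⇔ Connected a b) where

    consecutive⇒same-comp : ∀ a b → head a ≡ tail b → comp a ≡ comp b
    consecutive⇒same-comp a b e = Equivalence.from (comp-fibres a b) (fwd (consecutive⇒Path2 a b e) ◅ ε)

    isolated⇒comp-injective : ∀ {a b} → (∀ c → ¬ LAdj a c) → comp a ≡ comp b → a ≡ b
    isolated⇒comp-injective no-neighbour e = isolated no-neighbour (Equivalence.to (comp-fibres _ _) e)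

    incident-mixed : ∀ {v a} (m : Mixed v) → Incident a v → comp a ≡ comp (outArc (proj₂ m))
    incident-mixed (i , o) (inj₂ head≡v) = consecutive⇒same-comp _ (outArc o) head≡v
    incident-mixed (i , o) (inj₁ tail≡v) =
      trans (sym (consecutive⇒same-comp (inArc i) _ (sym tail≡v)))
            (consecutive⇒same-comp (inArc i) (outArc o) refl)

    key : Fin n → Maybe (Fin k)
    key v with Mixed? v
    ... | yes (_ , o) = just (comp (outArc o))
    ... | no _ = nothing

    key-mixed : ∀ {v a} → Mixed v → Incident a v → key v ≡ just (comp a)
    key-mixed {v} m inc with Mixed? v
    ... | yes m′ = cong just (sym (incident-mixed m′ inc))
    ... | no ¬m = contradiction m ¬m

    key-just⇒mixed : ∀ {v l} → key v ≡ just l → Mixed v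
    key-just⇒mixed {v} e with Mixed? v
    ... | yes m = m

    key-just⇒comp : ∀ {v l a} → key v ≡ just l → Incident a v → comp a ≡ l
    key-just⇒comp e inc = just-injective (trans (sym (key-mixed (key-just⇒mixed e) inc)) e)

    Chosen : Fin n → Set
    Chosen v = Mixed v × (∀ u → u <ᶠ v → key u ≢ key v)

    Chosen? : ∀ v → Dec (Chosen v)
    Chosen? v = Mixed? v ×-dec all? (λ u → (u <? v) →-dec ¬? (≡-decᴹ _≟ᶠ_ (key u) (key v)))

    mixed⇒chosen : ∀ {x} → Mixed x → ∃ λ v → Chosen v × key v ≡ key x
    mixed⇒chosen {x} mx =
      let v , kv≡kx , minimal = least (λ v → ≡-decᴹ _≟ᶠ_ (key v) (key x)) (x , refl)
          mv = key-just⇒mixed (trans kv≡kx (key-mixed {a = outArc (proj₂ mx)} mx (inj₁ refl)))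
      in v , (mv , λ u u<v ku≡kv → minimal u u<v (trans ku≡kv kv≡kx)) , kv≡kx

    InX : Fin n → Set
    InX v = Source v ⊎ Chosen v

    InX? : Decidable InX
    InX? v = Source? v ⊎-dec Chosen? v

    X : Subset n
    X = select InX?

    Cross : ArcOf D → Set
    Cross b = tail b ∈ X × head b ∈ ∁ X

    source∈X : ∀ {v} → Source v → v ∈ X
    source∈X s = select-∈ InX? (inj₁ s)

    chosen∈X : ∀ {v} → Chosen v → v ∈ X
    chosen∈X c = select-∈ InX? (inj₂ c)

    ∈∁X : ∀ {v} → ¬ Source v → ¬ Chosen v → v ∈ ∁ X
    ∈∁X ¬s ¬c = select-∁ InX? [ ¬s , ¬c ]

    -- A chosen successor w of v would be mixed with the key of v, against the minimality of v or of w.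
    chosen-successor∈∁X : ∀ {v w} → Chosen v → Arc D v w → w ∈ ∁ X
    chosen-successor∈∁X {v} {w} (mv , minv) p = ∈∁X (λ (_ , ¬in) → ¬in (v , p)) λ (mw , minw) →
      let kw≡kv = trans (key-mixed {a = b} mw (inj₂ refl)) (sym (key-mixed {a = b} mv (inj₁ refl)))
      in compare (<-cmp v w) minw kw≡kv
      where
      b = arc v w p
      compare : Tri (v <ᶠ w) (v ≡ w) (w <ᶠ v) → (∀ u → u <ᶠ w → key u ≢ key w) → key w ≡ key v → ⊥
      compare (tri< v<w _ _) minw kw≡kv = minw v v<w (sym kw≡kv)
      compare (tri≈ _ v≡w _) _ _ = Arc⇒≢ p v≡w
      compare (tri> _ _ w<v) _ kw≡kv = minv w w<v kw≡kv

    mixed⇒cross : ∀ {x a} → Mixed x → Incident a x → ∃ λ b → Cross b × comp b ≡ comp a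
    mixed⇒cross {a = a} mx inc =
      let v , chv@(mv , _) , kv≡kx = mixed⇒chosen mx
          b = outArc (proj₂ mv)
      in b , (chosen∈X chv , chosen-successor∈∁X chv (isArc b)) ,
         key-just⇒comp (trans kv≡kx (key-mixed mx inc)) (inj₁ refl)

    unmixed⇒cross : ∀ {a} → ¬ Mixed (tail a) → ¬ Mixed (head a) → Cross a
    unmixed⇒cross {arc u w p} ¬mu ¬mw =
      source∈X ((w , p) , λ i → ¬mu (i , (w , p))) , ∈∁X (λ (_ , ¬in) → ¬in (u , p)) (¬mw ∘ proj₁)

    cross-representative : ∀ a → ∃ λ b → Cross b × comp b ≡ comp a
    cross-representative a with Mixed? (tail a) | Mixed? (head a)
    ... | yes m | _ = mixed⇒cross m (inj₁ refl)
    ... | no _ | yes m = mixed⇒cross m (inj₂ refl)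
    ... | no ¬mt | no ¬mh = a , unmixed⇒cross {a} ¬mt ¬mh , refl

    cross-index : ∀ b → Cross b → Fin (∣ X ∣ * ∣ ∁ X ∣)
    cross-index _ (t , h) = combine (index X t) (index (∁ X) h)

    cross-index-injective : ∀ {b b′} (cb : Cross b) (cb′ : Cross b′) →
                            cross-index b cb ≡ cross-index b′ cb′ → b ≡ b′
    cross-index-injective (t , h) (t′ , h′) e =
      let e₁ , e₂ = combine-injective _ _ _ _ e
      in arc-≡ (index-injective X t t′ e₁) (index-injective (∁ X) h h′ e₂)

    representative : Fin k → ArcOf D
    representative i = proj₁ (cross-representative (proj₁ (comp-surjective i)))

    representative-cross : ∀ i → Cross (representative i)
    representative-cross i = proj₁ (proj₂ (cross-representative (proj₁ (comp-surjective i))))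

    comp-representative : ∀ i → comp (representative i) ≡ i
    comp-representative i =
      trans (proj₂ (proj₂ (cross-representative (proj₁ (comp-surjective i))))) (proj₂ (comp-surjective i) refl)

    encode : Fin k → Fin (∣ X ∣ * ∣ ∁ X ∣)
    encode i = cross-index (representative i) (representative-cross i)

    encode-injective : Injective _≡_ _≡_ encode
    encode-injective {i} {j} e =
      trans (sym (comp-representative i))
            (trans (cong comp (cross-index-injective _ _ e)) (comp-representative j))

    k≤∣X∣*∣∁X∣ : k ≤ ∣ X ∣ * ∣ ∁ X ∣
    k≤∣X∣*∣∁X∣ = injective⇒≤ encode-injective

    ∣X∣*∣∁X∣≤f : ∣ X ∣ * ∣ ∁ X ∣ ≤ f n
    ∣X∣*∣∁X∣≤f = subst (λ m → ∣ X ∣ * ∣ ∁ X ∣ ≤ f m) (∣p∣+∣∁p∣≡n X) (*≤f[+] ∣ X ∣ ∣ ∁ X ∣)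

    k≤f : k ≤ f n
    k≤f = ≤-trans k≤∣X∣*∣∁X∣ ∣X∣*∣∁X∣≤f

    module Extremal (k≡f : k ≡ f n) where

      ∣X∣*∣∁X∣≡f : ∣ X ∣ * ∣ ∁ X ∣ ≡ f n
      ∣X∣*∣∁X∣≡f = ≤-antisym ∣X∣*∣∁X∣≤f (subst (_≤ ∣ X ∣ * ∣ ∁ X ∣) k≡f k≤∣X∣*∣∁X∣)

      balanced : ∣ ∣ X ∣ - ∣ ∁ X ∣ ∣ ≤ 1
      balanced = Equivalence.to (*≡f[+]⇔∣-∣≤1 ∣ X ∣ ∣ ∁ X ∣) (trans ∣X∣*∣∁X∣≡f (cong f (sym (∣p∣+∣∁p∣≡n X))))

      encode-surjective : Surjective _≡_ _≡_ encode
      encode-surjective = injective⇒surjective (trans k≡f (sym ∣X∣*∣∁X∣≡f)) encode-injective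

      cross-arc : ∀ {v w} → v ∈ X → w ∈ ∁ X → Arc D v w
      cross-arc v∈X w∈∁X =
        let i , encode-i = encode-surjective (combine (index X v∈X) (index (∁ X) w∈∁X))
            e₁ , e₂ = combine-injective _ _ _ _ (encode-i refl)
        in subst₂ (Arc D) (index-injective X _ _ e₁) (index-injective (∁ X) _ _ e₂) (isArc (representative i))

      comp-cross-injective : ∀ {b b′} (cb : Cross b) (cb′ : Cross b′) → comp b ≡ comp b′ → b ≡ b′
      comp-cross-injective {b} {b′} cb cb′ e =
        cross-index-injective cb cb′ (trans (sym (encode-comp cb)) (trans (cong encode e) (encode-comp cb′)))
        where
        encode-comp : ∀ {c} (cc : Cross c) → encode (comp c) ≡ cross-index c cc
        encode-comp {c} cc =
          let i , encode-i = encode-surjective (cross-index c cc)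
              representative≡c = cross-index-injective (representative-cross i) cc (encode-i refl)
          in trans (cong encode (trans (cong comp (sym representative≡c)) (comp-representative i)))
                   (encode-i refl)

      unmixed⇒bipartite : (∀ v → ¬ Mixed v) → IsBalancedBipartiteOrientation D
      unmixed⇒bipartite ¬mixed =
        X , balanced , λ u v → mk⇔ (λ p → unmixed⇒cross {arc u v p} (¬mixed u) (¬mixed v)) (uncurry cross-arc)

      ∣∁X∣≤1⇒n≤3 : ∣ ∁ X ∣ ≤ 1 → n ≤ 3
      ∣∁X∣≤1⇒n≤3 ∣∁X∣≤1 = subst (_≤ 3) (∣p∣+∣∁p∣≡n X)
        (+-mono-≤ (≤-trans (m≤∣m-n∣+n ∣ X ∣ ∣ ∁ X ∣) (+-mono-≤ balanced ∣∁X∣≤1)) ∣∁X∣≤1)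

      chosen⇒∁X⊆⁅successor⁆ : ∀ {v w y} → Chosen v → Arc D v w → y ∈ ∁ X → y ≡ w
      chosen⇒∁X⊆⁅successor⁆ {v} {w} {y} chv@(mv , _) v→w y∈∁X =
        cong head (comp-cross-injective {arc v y (cross-arc v∈X y∈∁X)} {arc v w v→w}
          (v∈X , y∈∁X) (v∈X , chosen-successor∈∁X chv v→w)
          (trans (incident-mixed mv (inj₁ refl)) (sym (incident-mixed {a = arc v w v→w} mv (inj₁ refl)))))
        where
        v∈X : v ∈ X
        v∈X = chosen∈X chv

      chosen-predecessor∈X : ∀ {u v w} → Chosen v → Arc D u v → Arc D v w → u ∈ X
      chosen-predecessor∈X {u} {v} chv u→v v→w with u ∈? X
      ... | yes u∈X = u∈X
      ... | no u∉X =
        let u≡w = chosen⇒∁X⊆⁅successor⁆ chv v→w (x∉p⇒x∈∁p u∉X)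
        in contradiction (subst (Arc D v) (sym u≡w) v→w) (Arc⇒¬Arc-reverse u→v)

      chosen⇒TT3 : ∀ {v} → Chosen v → IsTT3 D
      chosen⇒TT3 {v} chv@(((u , u→v) , (w , v→w)) , _) = σ , (σ-injective , σ-surjective) , σ-table
        where
        u→w : Arc D u w
        u→w = cross-arc (chosen-predecessor∈X chv u→v v→w) (chosen-successor∈∁X chv v→w)

        σ : Fin 3 → Fin n
        σ zero = u
        σ (suc zero) = v
        σ (suc (suc zero)) = w

        σ-table : ∀ i j → D (σ i) (σ j) ≡ TT3 i j
        σ-table zero zero = strict u
        σ-table zero (suc zero) = u→v
        σ-table zero (suc (suc zero)) = u→w
        σ-table (suc zero) zero = asym u v u→v
        σ-table (suc zero) (suc zero) = strict v
        σ-table (suc zero) (suc (suc zero)) = v→w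
        σ-table (suc (suc zero)) zero = asym u w u→w
        σ-table (suc (suc zero)) (suc zero) = asym v w v→w
        σ-table (suc (suc zero)) (suc (suc zero)) = strict w

        σ-injective : Injective _≡_ _≡_ σ
        σ-injective = TT3-table⇒injective σ-table

        ∣∁X∣≤1 : ∣ ∁ X ∣ ≤ 1
        ∣∁X∣≤1 = ≤-trans
          (p⊆q⇒∣p∣≤∣q∣ λ y∈∁X → subst (_∈ ⁅ w ⁆) (sym (chosen⇒∁X⊆⁅successor⁆ chv v→w y∈∁X)) (x∈⁅x⁆ w))
          (≤-reflexive (∣⁅x⁆∣≡1 w))

        σ-surjective : Surjective _≡_ _≡_ σ
        σ-surjective =
          injective⇒surjective (≤-antisym (injective⇒≤ σ-injective) (∣∁X∣≤1⇒n≤3 ∣∁X∣≤1)) σ-injective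

      structure : IsTT3 D ⊎ IsBalancedBipartiteOrientation D
      structure with any? Mixed?
      ... | yes (_ , mx) = inj₁ (chosen⇒TT3 (proj₁ (proj₂ (mixed⇒chosen mx))))
      ... | no ∄mixed = inj₂ (unmixed⇒bipartite λ v m → ∄mixed (v , m))

    TT3⇒k≡f : IsTT3 D → k ≡ f n
    TT3⇒k≡f (σ , σ-bijective@(σ-injective , σ-surjective) , table) =
      ≤-antisym k≤f (subst (λ m → f m ≤ k) (bijective⇒≡ σ-bijective) (injective⇒≤ two-components))
      where
      preimage : Fin n → Fin 3
      preimage y = proj₁ (σ-surjective y)

      σ-preimage : ∀ y → σ (preimage y) ≡ y
      σ-preimage y = proj₂ (σ-surjective y) refl

      σ-arc : ∀ {i j} → Arc D (σ i) (σ j) → TT3 i j ≡ true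
      σ-arc {i} {j} p = trans (sym (table i j)) p

      σ₀→σ₂ : ArcOf D
      σ₀→σ₂ = arc (σ zero) (σ (suc (suc zero))) (table _ _)

      σ₀→σ₂-isolated : ∀ c → ¬ LAdj σ₀→σ₂ c
      σ₀→σ₂-isolated = source-sink-isolated
        (λ (x , p) → contradiction
          (trans (sym (TT3-source _)) (σ-arc (subst (λ z → Arc D z (σ zero)) (sym (σ-preimage x)) p))) λ ())
        (λ (y , p) → contradiction (σ-arc (subst (Arc D (σ (suc (suc zero)))) (sym (σ-preimage y)) p)) λ ())

      two-arcs : Fin 2 → ArcOf D
      two-arcs zero = arc (σ zero) (σ (suc zero)) (table _ _)
      two-arcs (suc zero) = σ₀→σ₂

      σ₂≡σ₁ : comp σ₀→σ₂ ≡ comp (two-arcs zero) → suc (suc zero) ≡ suc zero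
      σ₂≡σ₁ e = σ-injective (cong head (isolated⇒comp-injective σ₀→σ₂-isolated e))

      two-components : Injective _≡_ _≡_ (comp ∘ two-arcs)
      two-components {zero} {zero} _ = refl
      two-components {zero} {suc zero} e = contradiction (σ₂≡σ₁ (sym e)) λ ()
      two-components {suc zero} {zero} e = contradiction (σ₂≡σ₁ e) λ ()
      two-components {suc zero} {suc zero} _ = refl

    bipartite⇒k≡f : IsBalancedBipartiteOrientation D → k ≡ f n
    bipartite⇒k≡f (Y , balanced , arc⇔) =
      ≤-antisym k≤f (subst (_≤ k) ∣Y∣*∣∁Y∣≡f (injective⇒≤ (remQuot-injective {∣ Y ∣} ∣ ∁ Y ∣ ∘ pair-injective)))
      where
      tail∈Y : ∀ a → tail a ∈ Y
      tail∈Y a = proj₁ (Equivalence.to (arc⇔ _ _) (isArc a))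

      head∈∁Y : ∀ a → head a ∈ ∁ Y
      head∈∁Y a = proj₂ (Equivalence.to (arc⇔ _ _) (isArc a))

      arc-isolated : ∀ a c → ¬ LAdj a c
      arc-isolated a = source-sink-isolated
        (λ (x , p) → x∈∁p⇒x∉p (head∈∁Y (arc x _ p)) (tail∈Y a))
        (λ (y , p) → x∈∁p⇒x∉p (head∈∁Y a) (tail∈Y (arc _ y p)))

      pair-arc : Fin ∣ Y ∣ × Fin ∣ ∁ Y ∣ → ArcOf D
      pair-arc (i , j) =
        arc (element Y i) (element (∁ Y) j) (Equivalence.from (arc⇔ _ _) (element-∈ Y i , element-∈ (∁ Y) j))

      pair-injective : Injective _≡_ _≡_ (comp ∘ pair-arc)
      pair-injective e =
        let same-arc = isolated⇒comp-injective (arc-isolated _) e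
        in cong₂ _,_ (element-injective Y (cong tail same-arc)) (element-injective (∁ Y) (cong head same-arc))

      ∣Y∣*∣∁Y∣≡f : ∣ Y ∣ * ∣ ∁ Y ∣ ≡ f n
      ∣Y∣*∣∁Y∣≡f = trans (Equivalence.from (*≡f[+]⇔∣-∣≤1 ∣ Y ∣ ∣ ∁ Y ∣) balanced) (cong f (∣p∣+∣∁p∣≡n Y))

theorem2p4 : ∀ (n : ℕ) (D : Digraph n) → Strict D → Asymmetric D →
    ∀ (k : ℕ) → NumComponents D k →
      k ≤ f n × (k ≡ f n ⇔ (IsTT3 D ⊎ IsBalancedBipartiteOrientation D))
theorem2p4 n D strict asym k (comp , comp-surjective , comp-fibres) =
  k≤f , mk⇔ Extremal.structure [ TT3⇒k≡f , bipartite⇒k≡f ]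
  where
  open LineGraph D strict asym
  open Components comp comp-surjective comp-fibres
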